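{- Let $S=(E,\mathcal F)$ be a proper set system and let $X,Y,Z$ be pairwise disjoint subsets of $E$. Call a set $F$ admissible if $F\subseteq E-(X\cup Y\cup Z)$ and the number of sets $F'\in\mathcal F$ with $F\cup Y\subseteq F'\subseteq F\cup Y\cup Z$ is odd. If at least one admissible set exists, then applying to $S$ the single-element operations of deleting each element of $X$, contracting each element of $Y$ and Penrose contracting each element of $Z$, in any order whatsoever, always yields the same set system, and a set is feasible in that set system if and only if it is admissible.
   Context: A set system is a pair $S=(E,\mathcal F)$ where $E$ is a finite set and $\mathcal F$ is a collection of subsets of $E$ (the feasible sets); $S$ is proper if $\mathcal F\neq\emptyset$. For $e\in E$: $e$ is a loop if it lies in no feasible set, and a coloop if it lies in every feasible set. If $e$ is not a loop, $S/e=(E-e,\{F-e: e\in F\in\mathcal F\})$; if $e$ is not a coloop, $S\setminus e=(E-e,\{F\in\mathcal F: e\notin F\})$; if $e$ is a loop or a coloop, whichever of $S/e$, $S\setminus e$ is undefined is set equal to the other. For $A\subseteq E$, the loop complementation $S+A$ is the set system on $E$ in which $F\subseteq E$ is feasible if and only if $S$ has an odd number of feasible sets $F'$ with $F-A\subseteq F'\subseteq F$ (write $S+e$ for $S+\{e\}$). The Penrose contraction of $e$ is $S\ddagger e=(S+e)/e$. -}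

module Defs where

open import Data.Nat using (ℕ; zero; suc; _%_; _≡ᵇ_)
open import Data.Bool using (Bool; true; false; _∧_; _∨_; not; T; if_then_else_)
open import Data.Fin using (Fin)
open import Data.Fin.Subset using (Subset; outside; inside; _⊆_; _∪_; _∩_; _─_; _-_; ⁅_⁆; _∈_; Empty)
open import Data.Fin.Subset.Properties using (_⊆?_)
open import Data.Vec using ([]; _∷_; lookup)
open import Data.List using (List; []; _∷_; [_]; _++_; map; filter; length; foldl)
open import Data.Bool.ListAction using (any; all)
open import Data.List.Relation.Unary.Unique.Propositional using (Unique)
import Data.List.Membership.Propositional as LMem
open import Data.Product using (Σ; ∃; _×_; _,_; proj₁)
open import Relation.Nullary.Decidable using (⌊_⌋)
open import Relation.Unary using (Pred)
open import Relation.Binary.PropositionalEquality using (_≡_)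
open import Function.Bundles using (_⇔_)

-- The universe Fin n is fixed;
-- the ground set shrinks under minor operations.  The family of feasible
-- sets is given by a Boolean predicate `feas`; a set F counts as feasible
-- only if moreover F ⊆ ground (see `isFeasible`).
record SetSystem (n : ℕ) : Set where
  constructor mkSS
  field
    ground : Subset n
    feas   : Subset n → Bool
open SetSystem public

allSubsets : (n : ℕ) → List (Subset n)
allSubsets zero    = [ [] ]
allSubsets (suc n) = map (outside ∷_) (allSubsets n) ++ map (inside ∷_) (allSubsets n)

_⊆ᵇ_ : {n : ℕ} → Subset n → Subset n → Bool
A ⊆ᵇ B = ⌊ A ⊆? B ⌋

isFeasible : {n : ℕ} → SetSystem n → Subset n → Bool
isFeasible S F = (F ⊆ᵇ ground S) ∧ feas S F

Feasible : {n : ℕ} → SetSystem n → Subset n → Set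
Feasible S F = T (isFeasible S F)

Proper : {n : ℕ} → SetSystem n → Set
Proper S = ∃ λ F → Feasible S F

countBetween : {n : ℕ} → SetSystem n → Subset n → Subset n → ℕ
countBetween {n} S A B =
  length (filter (λ F' → T? (isFeasible S F' ∧ (A ⊆ᵇ F') ∧ (F' ⊆ᵇ B))) (allSubsets n))
  where
    open import Relation.Nullary.Decidable using (Dec)
    open import Data.Bool.Properties using (T?)

isOdd : ℕ → Bool
isOdd k = (k % 2) ≡ᵇ 1

isLoop : {n : ℕ} → SetSystem n → Fin n → Bool
isLoop {n} S e = not (any (λ F → isFeasible S F ∧ lookup F e) (allSubsets n))

isColoop : {n : ℕ} → SetSystem n → Fin n → Bool
isColoop {n} S e = all (λ F → not (isFeasible S F) ∨ lookup F e) (allSubsets n)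

-- raw contraction  (E - e, {F - e : e ∈ F ∈ 𝓕})
rawContract : {n : ℕ} → SetSystem n → Fin n → SetSystem n
rawContract S e = mkSS (ground S - e) (λ G → not (lookup G e) ∧ isFeasible S (G ∪ ⁅ e ⁆))

rawDelete : {n : ℕ} → SetSystem n → Fin n → SetSystem n
rawDelete S e = mkSS (ground S - e) (λ G → not (lookup G e) ∧ isFeasible S G)

contract : {n : ℕ} → SetSystem n → Fin n → SetSystem n
contract S e = if isLoop S e then rawDelete S e else rawContract S e

-- S \ e : deletion; if e is a coloop, S \ e := S / e
-- (if e is both a loop and a coloop, both raw operations give the empty family)
delete : {n : ℕ} → SetSystem n → Fin n → SetSystem n
delete S e = if isColoop S e then rawContract S e else rawDelete S e

loopComp : {n : ℕ} → SetSystem n → Subset n → SetSystem n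
loopComp S A = mkSS (ground S) (λ F → isOdd (countBetween S (F ─ A) F))

penrose : {n : ℕ} → SetSystem n → Fin n → SetSystem n
penrose S e = contract (loopComp S ⁅ e ⁆) e

data Op : Set where
  del con pen : Op

applyOp : {n : ℕ} → SetSystem n → Fin n × Op → SetSystem n
applyOp S (e , del) = delete S e
applyOp S (e , con) = contract S e
applyOp S (e , pen) = penrose S e

applyOps : {n : ℕ} → SetSystem n → List (Fin n × Op) → SetSystem n
applyOps = foldl applyOp

ValidOrder : {n : ℕ} → Subset n → Subset n → Subset n → List (Fin n × Op) → Set
ValidOrder X Y Z ops =
  Unique (map proj₁ ops) ×
  (∀ e → (e , del) LMem.∈ ops ⇔ e ∈ X) ×
  (∀ e → (e , con) LMem.∈ ops ⇔ e ∈ Y) ×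
  (∀ e → (e , pen) LMem.∈ ops ⇔ e ∈ Z)

Admissible : {n : ℕ} → SetSystem n → Subset n → Subset n → Subset n → Subset n → Set
Admissible S X Y Z F =
  F ⊆ (ground S ─ (X ∪ Y ∪ Z)) ×
  T (isOdd (countBetween S (F ∪ Y) (F ∪ Y ∪ Z)))

SameSystem : {n : ℕ} → SetSystem n → SetSystem n → Set
SameSystem S T′ = (ground S ≡ ground T′) × (∀ F → Feasible S F ⇔ Feasible T′ F)

module Submission where

-- Write σ_S(A, B) for the parity of the number of feasible sets F′ with
-- A ⊆ F′ ⊆ B, so that F is admissible iff F ⊆ E - (X ∪ Y ∪ Z) and σ_S(F ∪ Y, F ∪ Y ∪ Z) = 1.
-- Each single-element operation on e changes σ in a controlled way:
--   deletion            σ_{S\e}(A, B)          = σ_S(A, B)   when e ∉ B,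
--   contraction         σ_{S/e}(A - e, B - e)  = σ_S(A, B)   when e ∈ A and e ∈ B,
--   Penrose contraction σ_{S‡e}(A, B - e)      = σ_S(A, B)   when e ∉ A, e ∈ B, e ∈ E.
-- These are identities about parities of a Boolean function over the cube of subsets, proved by
-- splitting the cube along e.  An admissible set rules out the degenerate cases of the
-- definitions (deleting a coloop, contracting a loop), because those would force σ = 0.
-- Hence one operation on e ∈ X ∪ Y ∪ Z turns the admissible sets for (S, X, Y, Z) into the
-- admissible sets for (S′, X - e, Y - e, Z - e), and induction along the sequence of
-- operations ends at X = Y = Z = ∅, where admissible means feasible.

open import Defs
open import Data.Nat using (ℕ; zero; suc)
open import Data.Bool using (Bool; true; false; _∧_; _∨_; not; _xor_; T; if_then_else_)
open import Data.Bool.Properties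
  using ( T?; T-≡; T-∧; ¬-not; not-¬; not-involutive; xor-assoc; xor-identityʳ; xor-∧-commutativeRing
        ; ∧-assoc; ∧-identityʳ; ∧-zeroʳ; ∧-conicalˡ; ∧-conicalʳ; ∨-identityʳ; ∨-zeroʳ
        ; ∧-distribˡ-xor; ∧-distribʳ-xor )
open import Algebra.Bundles using (CommutativeRing)
open import Algebra.Properties.CommutativeSemigroup
  (CommutativeRing.+-commutativeSemigroup xor-∧-commutativeRing) using (interchange)
open import Data.Fin using (Fin; zero; suc)
open import Data.Fin.Subset
  using (Subset; outside; inside; _∈_; _∉_; _⊆_; _∩_; _∪_; _─_; _-_; ⁅_⁆; ⊥; Empty)
open import Data.Fin.Subset.Properties
  using (_⊆?_; ∪-identityʳ; ∩-comm; p─⊥≡p; p─q⊆p; x∈p∧x≢y⇒x∈p-y; x∈p∩q⁺; x∈p∩q⁻; Empty-unique)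
open import Data.Vec using ([]; _∷_; lookup; there)
open import Data.Vec.Properties using (lookup-zipWith; []=⇒lookup; lookup⇒[]=)
open import Data.List using (List; []; _∷_; _++_; map; filter; length)
open import Data.Bool.ListAction using (any)
import Data.List.Membership.Propositional as List
open import Data.List.Membership.Propositional using (lose)
open import Data.List.Membership.Propositional.Properties using (∈-map⁺; ∈-++⁺ˡ; ∈-++⁺ʳ)
open import Data.List.Relation.Unary.Any using () renaming (here to hereₗ; there to thereₗ)
open import Data.List.Relation.Unary.Any.Properties using (any⁺)
import Data.List.Relation.Unary.All as All
open import Data.List.Relation.Unary.All.Properties using (all⁺)
open import Data.List.Relation.Unary.AllPairs using () renaming (_∷_ to _∷ₚ_)
open import Data.List.Relation.Unary.Unique.Propositional using (Unique)
open import Data.Product using (∃; _×_; _,_; proj₁; proj₂)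
open import Data.Empty using (⊥-elim)
open import Function using (id; case_of_)
open import Function.Bundles using (_⇔_; mk⇔; Equivalence)
open import Function.Construct.Composition using (_⇔-∘_)
open import Function.Construct.Symmetry using (⇔-sym)
open import Relation.Nullary.Decidable using (⌊⌋-map′; toWitness; fromWitness)
open import Relation.Binary.PropositionalEquality
open ≡-Reasoning

isOdd-suc : ∀ k → isOdd (suc k) ≡ not (isOdd k)
isOdd-suc zero    = refl
isOdd-suc (suc k) rewrite isOdd-suc k = sym (not-involutive (isOdd k))

xorAll : {A : Set} → (A → Bool) → List A → Bool
xorAll p []       = false
xorAll p (x ∷ xs) = p x xor xorAll p xs

isOdd-filter : {A : Set} (p : A → Bool) (xs : List A) →
  isOdd (length (filter (λ x → T? (p x)) xs)) ≡ xorAll p xs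
isOdd-filter p [] = refl
isOdd-filter p (x ∷ xs) with p x
... | true  = trans (isOdd-suc (length (filter (λ x → T? (p x)) xs))) (cong not (isOdd-filter p xs))
... | false = isOdd-filter p xs

xorAll-++ : {A : Set} (p : A → Bool) (xs ys : List A) →
  xorAll p (xs ++ ys) ≡ xorAll p xs xor xorAll p ys
xorAll-++ p []       ys = refl
xorAll-++ p (x ∷ xs) ys = trans (cong (p x xor_) (xorAll-++ p xs ys)) (sym (xor-assoc (p x) _ _))

xorAll-map : {A B : Set} (p : B → Bool) (f : A → B) (xs : List A) →
  xorAll p (map f xs) ≡ xorAll (λ x → p (f x)) xs
xorAll-map p f []       = refl
xorAll-map p f (x ∷ xs) = cong (p (f x) xor_) (xorAll-map p f xs)

parityOf : (n : ℕ) → (Subset n → Bool) → Bool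
parityOf zero    f = f []
parityOf (suc n) f = parityOf n (λ G → f (outside ∷ G)) xor parityOf n (λ G → f (inside ∷ G))

xorAll-allSubsets : (n : ℕ) (f : Subset n → Bool) → xorAll f (allSubsets n) ≡ parityOf n f
xorAll-allSubsets zero    f = xor-identityʳ (f [])
xorAll-allSubsets (suc n) f = begin
  xorAll f (map (outside ∷_) (allSubsets n) ++ map (inside ∷_) (allSubsets n))
    ≡⟨ xorAll-++ f (map (outside ∷_) (allSubsets n)) _ ⟩
  xorAll f (map (outside ∷_) (allSubsets n)) xor xorAll f (map (inside ∷_) (allSubsets n))
    ≡⟨ cong₂ _xor_ (trans (xorAll-map f _ (allSubsets n)) (xorAll-allSubsets n _))
                   (trans (xorAll-map f _ (allSubsets n)) (xorAll-allSubsets n _)) ⟩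
  parityOf (suc n) f ∎

parity-cong : (n : ℕ) {f g : Subset n → Bool} → (∀ G → f G ≡ g G) → parityOf n f ≡ parityOf n g
parity-cong zero    f≗g = f≗g []
parity-cong (suc n) f≗g = cong₂ _xor_ (parity-cong n (λ G → f≗g (outside ∷ G)))
                                      (parity-cong n (λ G → f≗g (inside ∷ G)))

parity-vanish : (n : ℕ) {f : Subset n → Bool} → (∀ G → f G ≡ false) → parityOf n f ≡ false
parity-vanish zero    f≗0 = f≗0 []
parity-vanish (suc n) f≗0 = cong₂ _xor_ (parity-vanish n (λ G → f≗0 (outside ∷ G)))
                                        (parity-vanish n (λ G → f≗0 (inside ∷ G)))

xor-empty : (n : ℕ) (b : Bool) → b xor parityOf n (λ _ → false) ≡ b
xor-empty n b = trans (cong (b xor_) (parity-vanish n (λ _ → refl))) (xor-identityʳ b)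

parity-scale : (n : ℕ) (c : Bool) (f : Subset n → Bool) → parityOf n (λ H → c ∧ f H) ≡ c ∧ parityOf n f
parity-scale n false f = parity-vanish n (λ _ → refl)
parity-scale n true  f = refl

parity-xor : (n : ℕ) (f g : Subset n → Bool) →
  parityOf n (λ G → f G xor g G) ≡ parityOf n f xor parityOf n g
parity-xor zero    f g = refl
parity-xor (suc n) f g =
  trans (cong₂ _xor_ (parity-xor n (λ G → f (outside ∷ G)) (λ G → g (outside ∷ G)))
                     (parity-xor n (λ G → f (inside ∷ G)) (λ G → g (inside ∷ G))))
        (interchange (half f outside) (half g outside) (half f inside) (half g inside))
  where
  half : (Subset (suc n) → Bool) → Bool → Bool
  half h x = parityOf n (λ G → h (x ∷ G))

-- Splitting the Boolean cube along coordinate e: every set is H or H ∪ {e} with e ∉ H.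
parity-split : (n : ℕ) (e : Fin n) (f : Subset n → Bool) →
  parityOf n f ≡ parityOf n (λ G → not (lookup G e) ∧ f G)
                 xor parityOf n (λ G → not (lookup G e) ∧ f (G ∪ ⁅ e ⁆))
parity-split (suc n) zero f = sym (cong₂ _xor_
  (xor-empty n (parityOf n (λ G → f (outside ∷ G))))
  (trans (xor-empty n (parityOf n (λ G → f (inside ∷ (G ∪ ⊥))))) (parity-cong n (λ G → cong (λ H → f (inside ∷ H)) (∪-identityʳ G)))))
parity-split (suc n) (suc e) f =
  trans (cong₂ _xor_ (parity-split n e (λ G → f (outside ∷ G))) (parity-split n e (λ G → f (inside ∷ G))))
        (interchange (half outside id) (half outside (_∪ ⁅ e ⁆)) (half inside id) (half inside (_∪ ⁅ e ⁆)))
  where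
  half : Bool → (Subset n → Subset n) → Bool
  half x h = parityOf n (λ G → not (lookup G e) ∧ f (x ∷ h G))

⊆ᵇ-∷ : {n : ℕ} (x y : Bool) (p q : Subset n) → (x ∷ p) ⊆ᵇ (y ∷ q) ≡ (not x ∨ y) ∧ (p ⊆ᵇ q)
⊆ᵇ-∷ outside y       p q = ⌊⌋-map′ _ _ (p ⊆? q)
⊆ᵇ-∷ inside  outside p q = refl
⊆ᵇ-∷ inside  inside  p q = ⌊⌋-map′ _ _ (p ⊆? q)

⊆ᵇ-minus : {n : ℕ} (G B : Subset n) (e : Fin n) → G ⊆ᵇ (B - e) ≡ (G ⊆ᵇ B) ∧ not (lookup G e)
⊆ᵇ-minus (x ∷ G) (y ∷ B) zero = begin
  (x ∷ G) ⊆ᵇ (outside ∷ (B ─ ⊥))   ≡⟨ ⊆ᵇ-∷ x outside G (B ─ ⊥) ⟩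
  (not x ∨ false) ∧ (G ⊆ᵇ (B ─ ⊥)) ≡⟨ cong₂ _∧_ (∨-identityʳ (not x)) (cong (G ⊆ᵇ_) (p─⊥≡p B)) ⟩
  not x ∧ (G ⊆ᵇ B)                 ≡⟨ heads x ⟩
  ((not x ∨ y) ∧ (G ⊆ᵇ B)) ∧ not x ≡⟨ cong (_∧ not x) (⊆ᵇ-∷ x y G B) ⟨
  ((x ∷ G) ⊆ᵇ (y ∷ B)) ∧ not x     ∎
  where
  heads : ∀ x → not x ∧ (G ⊆ᵇ B) ≡ ((not x ∨ y) ∧ (G ⊆ᵇ B)) ∧ not x
  heads outside = sym (∧-identityʳ _)
  heads inside  = sym (∧-zeroʳ _)
⊆ᵇ-minus (x ∷ G) (y ∷ B) (suc e) = begin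
  (x ∷ G) ⊆ᵇ (y ∷ (B - e))                      ≡⟨ ⊆ᵇ-∷ x y G (B - e) ⟩
  (not x ∨ y) ∧ (G ⊆ᵇ (B - e))                  ≡⟨ cong ((not x ∨ y) ∧_) (⊆ᵇ-minus G B e) ⟩
  (not x ∨ y) ∧ ((G ⊆ᵇ B) ∧ not (lookup G e))   ≡⟨ ∧-assoc (not x ∨ y) _ _ ⟨
  ((not x ∨ y) ∧ (G ⊆ᵇ B)) ∧ not (lookup G e)   ≡⟨ cong (_∧ not (lookup G e)) (⊆ᵇ-∷ x y G B) ⟨
  ((x ∷ G) ⊆ᵇ (y ∷ B)) ∧ not (lookup G e)       ∎

∪⁅⁆-⊆ᵇ : {n : ℕ} (G B : Subset n) (e : Fin n) → (G ∪ ⁅ e ⁆) ⊆ᵇ B ≡ (G ⊆ᵇ B) ∧ lookup B e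
∪⁅⁆-⊆ᵇ (x ∷ G) (y ∷ B) zero = begin
  ((x ∨ true) ∷ (G ∪ ⊥)) ⊆ᵇ (y ∷ B)       ≡⟨ ⊆ᵇ-∷ (x ∨ true) y (G ∪ ⊥) B ⟩
  (not (x ∨ true) ∨ y) ∧ ((G ∪ ⊥) ⊆ᵇ B)   ≡⟨ cong₂ _∧_ (cong (λ b → not b ∨ y) (∨-zeroʳ x))
                                                       (cong (_⊆ᵇ B) (∪-identityʳ G)) ⟩
  y ∧ (G ⊆ᵇ B)                            ≡⟨ heads x y ⟩
  ((not x ∨ y) ∧ (G ⊆ᵇ B)) ∧ y            ≡⟨ cong (_∧ y) (⊆ᵇ-∷ x y G B) ⟨
  ((x ∷ G) ⊆ᵇ (y ∷ B)) ∧ y                ∎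
  where
  heads : ∀ x y → y ∧ (G ⊆ᵇ B) ≡ ((not x ∨ y) ∧ (G ⊆ᵇ B)) ∧ y
  heads x       outside = sym (∧-zeroʳ _)
  heads outside inside  = sym (∧-identityʳ _)
  heads inside  inside  = sym (∧-identityʳ _)
∪⁅⁆-⊆ᵇ (x ∷ G) (y ∷ B) (suc e) = begin
  ((x ∨ false) ∷ (G ∪ ⁅ e ⁆)) ⊆ᵇ (y ∷ B)       ≡⟨ ⊆ᵇ-∷ (x ∨ false) y (G ∪ ⁅ e ⁆) B ⟩
  (not (x ∨ false) ∨ y) ∧ ((G ∪ ⁅ e ⁆) ⊆ᵇ B)   ≡⟨ cong₂ _∧_ (cong (λ b → not b ∨ y) (∨-identityʳ x))
                                                            (∪⁅⁆-⊆ᵇ G B e) ⟩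
  (not x ∨ y) ∧ ((G ⊆ᵇ B) ∧ lookup B e)        ≡⟨ ∧-assoc (not x ∨ y) _ _ ⟨
  ((not x ∨ y) ∧ (G ⊆ᵇ B)) ∧ lookup B e        ≡⟨ cong (_∧ lookup B e) (⊆ᵇ-∷ x y G B) ⟨
  ((x ∷ G) ⊆ᵇ (y ∷ B)) ∧ lookup B e            ∎

⊆ᵇ-∪⁅⁆ : {n : ℕ} (A G : Subset n) (e : Fin n) → A ⊆ᵇ (G ∪ ⁅ e ⁆) ≡ (A - e) ⊆ᵇ G
⊆ᵇ-∪⁅⁆ (x ∷ A) (y ∷ G) zero = begin
  (x ∷ A) ⊆ᵇ ((y ∨ true) ∷ (G ∪ ⊥))       ≡⟨ ⊆ᵇ-∷ x (y ∨ true) A (G ∪ ⊥) ⟩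
  (not x ∨ (y ∨ true)) ∧ (A ⊆ᵇ (G ∪ ⊥))   ≡⟨ cong₂ _∧_ (trans (cong (not x ∨_) (∨-zeroʳ y)) (∨-zeroʳ (not x)))
                                                       (cong (A ⊆ᵇ_) (∪-identityʳ G)) ⟩
  A ⊆ᵇ G                                  ≡⟨ cong (_⊆ᵇ G) (p─⊥≡p A) ⟨
  (A ─ ⊥) ⊆ᵇ G                            ≡⟨ ⊆ᵇ-∷ outside y (A ─ ⊥) G ⟨
  (outside ∷ (A ─ ⊥)) ⊆ᵇ (y ∷ G)          ∎
⊆ᵇ-∪⁅⁆ (x ∷ A) (y ∷ G) (suc e) = begin
  (x ∷ A) ⊆ᵇ ((y ∨ false) ∷ (G ∪ ⁅ e ⁆))        ≡⟨ ⊆ᵇ-∷ x (y ∨ false) A (G ∪ ⁅ e ⁆) ⟩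
  (not x ∨ (y ∨ false)) ∧ (A ⊆ᵇ (G ∪ ⁅ e ⁆))    ≡⟨ cong₂ _∧_ (cong (not x ∨_) (∨-identityʳ y)) (⊆ᵇ-∪⁅⁆ A G e) ⟩
  (not x ∨ y) ∧ ((A - e) ⊆ᵇ G)                  ≡⟨ ⊆ᵇ-∷ x y (A - e) G ⟨
  (x ∷ (A - e)) ⊆ᵇ (y ∷ G)                      ∎

minus-absent : {n : ℕ} (A : Subset n) (e : Fin n) → lookup A e ≡ false → A - e ≡ A
minus-absent (outside ∷ A) zero    refl = cong (outside ∷_) (p─⊥≡p A)
minus-absent (x ∷ A)       (suc e) e∉A  = cong (x ∷_) (minus-absent A e e∉A)

∪⁅⁆-minus : {n : ℕ} (G : Subset n) (e : Fin n) → lookup G e ≡ false → (G ∪ ⁅ e ⁆) - e ≡ G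
∪⁅⁆-minus (outside ∷ G) zero    refl = cong (outside ∷_) (trans (p─⊥≡p (G ∪ ⊥)) (∪-identityʳ G))
∪⁅⁆-minus (x ∷ G)       (suc e) e∉G  = cong₂ _∷_ (∨-identityʳ x) (∪⁅⁆-minus G e e∉G)

lookup-∪⁅⁆ : {n : ℕ} (H : Subset n) (e : Fin n) → lookup (H ∪ ⁅ e ⁆) e ≡ true
lookup-∪⁅⁆ (x ∷ H) zero    = ∨-zeroʳ x
lookup-∪⁅⁆ (x ∷ H) (suc e) = lookup-∪⁅⁆ H e

⊆ᵇ-escape : {n : ℕ} (H B : Subset n) (e : Fin n) → lookup H e ≡ true → lookup B e ≡ false →
  H ⊆ᵇ B ≡ false
⊆ᵇ-escape H B e e∈H e∉B = begin
  H ⊆ᵇ B                          ≡⟨ cong (H ⊆ᵇ_) (minus-absent B e e∉B) ⟨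
  H ⊆ᵇ (B - e)                    ≡⟨ ⊆ᵇ-minus H B e ⟩
  (H ⊆ᵇ B) ∧ not (lookup H e)     ≡⟨ cong (λ b → (H ⊆ᵇ B) ∧ not b) e∈H ⟩
  (H ⊆ᵇ B) ∧ false                ≡⟨ ∧-zeroʳ _ ⟩
  false                           ∎

⊆ᵇ-absent : {n : ℕ} (A B : Subset n) (e : Fin n) → A ⊆ᵇ B ≡ true → lookup B e ≡ false → lookup A e ≡ false
⊆ᵇ-absent A B e A⊆B e∉B = ¬-not (λ e∈A → not-¬ A⊆B (⊆ᵇ-escape A B e e∈A e∉B))

⊆ᵇ-present : {n : ℕ} (A B : Subset n) (e : Fin n) → A ⊆ᵇ B ≡ true → lookup A e ≡ true → lookup B e ≡ true
⊆ᵇ-present A B e A⊆B e∈A = ¬-not (λ e∉B → not-¬ e∈A (⊆ᵇ-absent A B e A⊆B e∉B))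

⊆ᵇ-minus-avoid : {n : ℕ} (G B : Subset n) (e : Fin n) → lookup G e ≡ false → G ⊆ᵇ (B - e) ≡ G ⊆ᵇ B
⊆ᵇ-minus-avoid G B e e∉G =
  trans (⊆ᵇ-minus G B e) (trans (cong (λ b → (G ⊆ᵇ B) ∧ not b) e∉G) (∧-identityʳ (G ⊆ᵇ B)))

∪⁅⁆-⊆ᵇ-inside : {n : ℕ} (G B : Subset n) (e : Fin n) → lookup B e ≡ true → (G ∪ ⁅ e ⁆) ⊆ᵇ B ≡ G ⊆ᵇ B
∪⁅⁆-⊆ᵇ-inside G B e e∈B =
  trans (∪⁅⁆-⊆ᵇ G B e) (trans (cong ((G ⊆ᵇ B) ∧_) e∈B) (∧-identityʳ (G ⊆ᵇ B)))

interval : {n : ℕ} → (Subset n → Bool) → Subset n → Subset n → Bool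
interval {n} g A B = parityOf n (λ H → g H ∧ (A ⊆ᵇ H) ∧ (H ⊆ᵇ B))

interval-cong : {n : ℕ} {g g′ : Subset n → Bool} (A B : Subset n) → (∀ H → g H ≡ g′ H) →
  interval g A B ≡ interval g′ A B
interval-cong {n} A B g≗g′ = parity-cong n (λ H → cong (λ b → b ∧ (A ⊆ᵇ H) ∧ (H ⊆ᵇ B)) (g≗g′ H))

interval-∷ : {n : ℕ} (g : Subset (suc n) → Bool) (x y : Bool) (A B : Subset n) →
  interval g (x ∷ A) (y ∷ B) ≡
    (not x ∧ interval (λ H → g (outside ∷ H)) A B) xor (y ∧ interval (λ H → g (inside ∷ H)) A B)
interval-∷ {n} g x y A B = cong₂ _xor_
  (trans (parity-cong n (low x)) (parity-scale n (not x) _))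
  (trans (parity-cong n (high y)) (parity-scale n y _))
  where
  low : ∀ x H → g (outside ∷ H) ∧ ((x ∷ A) ⊆ᵇ (outside ∷ H)) ∧ ((outside ∷ H) ⊆ᵇ (y ∷ B))
              ≡ not x ∧ (g (outside ∷ H) ∧ (A ⊆ᵇ H) ∧ (H ⊆ᵇ B))
  low outside H rewrite ⊆ᵇ-∷ outside outside A H | ⊆ᵇ-∷ outside y H B = refl
  low inside  H = ∧-zeroʳ (g (outside ∷ H))
  high : ∀ y H → g (inside ∷ H) ∧ ((x ∷ A) ⊆ᵇ (inside ∷ H)) ∧ ((inside ∷ H) ⊆ᵇ (y ∷ B))
               ≡ y ∧ (g (inside ∷ H) ∧ (A ⊆ᵇ H) ∧ (H ⊆ᵇ B))
  high outside H = trans (cong (g (inside ∷ H) ∧_) (∧-zeroʳ ((x ∷ A) ⊆ᵇ (inside ∷ H)))) (∧-zeroʳ (g (inside ∷ H)))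
  high inside  H rewrite ⊆ᵇ-∷ x inside A H | ⊆ᵇ-∷ inside inside H B | ∨-zeroʳ (not x) = refl

interval-point : {n : ℕ} (g : Subset n → Bool) (G : Subset n) → interval g G G ≡ g G
interval-point g [] = ∧-identityʳ (g [])
interval-point g (outside ∷ G) =
  trans (interval-∷ g outside outside G G)
        (trans (cong (_xor false) (interval-point (λ H → g (outside ∷ H)) G)) (xor-identityʳ _))
interval-point g (inside ∷ G) =
  trans (interval-∷ g inside inside G G) (interval-point (λ H → g (inside ∷ H)) G)

interval-pair : {n : ℕ} (g : Subset n → Bool) (G : Subset n) (e : Fin n) → lookup G e ≡ false →
  interval g G (G ∪ ⁅ e ⁆) ≡ g G xor g (G ∪ ⁅ e ⁆)
interval-pair g (outside ∷ G) zero refl rewrite ∪-identityʳ G =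
  trans (interval-∷ g outside inside G G)
        (cong₂ _xor_ (interval-point (λ H → g (outside ∷ H)) G) (interval-point (λ H → g (inside ∷ H)) G))
interval-pair g (outside ∷ G) (suc e) e∉G =
  trans (interval-∷ g outside outside G (G ∪ ⁅ e ⁆))
        (trans (cong (_xor false) (interval-pair (λ H → g (outside ∷ H)) G e e∉G)) (xor-identityʳ _))
interval-pair g (inside ∷ G) (suc e) e∉G =
  trans (interval-∷ g inside inside G (G ∪ ⁅ e ⁆)) (interval-pair (λ H → g (inside ∷ H)) G e e∉G)

interval-empty : {n : ℕ} (g : Subset n → Bool) (A B : Subset n) →
  (∀ H → A ⊆ᵇ H ≡ true → H ⊆ᵇ B ≡ true → g H ≡ false) → interval g A B ≡ false
interval-empty {n} g A B none = parity-vanish n summand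
  where
  summand : ∀ H → g H ∧ (A ⊆ᵇ H) ∧ (H ⊆ᵇ B) ≡ false
  summand H with g H in gH | A ⊆ᵇ H in A⊆H | H ⊆ᵇ B in H⊆B
  ... | false | _     | _     = refl
  ... | true  | false | _     = refl
  ... | true  | true  | false = refl
  ... | true  | true  | true  = trans (sym gH) (none H A⊆H H⊆B)

-- Restricting g to sets avoiding e does not change intervals whose top avoids e
-- (the parity identity behind deletion).
interval-avoiding : {n : ℕ} (g : Subset n → Bool) (A B : Subset n) (e : Fin n) → lookup B e ≡ false →
  interval (λ H → not (lookup H e) ∧ g H) A B ≡ interval g A B
interval-avoiding {n} g A B e e∉B = parity-cong n summand
  where
  summand : ∀ H → (not (lookup H e) ∧ g H) ∧ (A ⊆ᵇ H) ∧ (H ⊆ᵇ B) ≡ g H ∧ (A ⊆ᵇ H) ∧ (H ⊆ᵇ B)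
  summand H with lookup H e in e∈H
  ... | false = refl
  ... | true  = sym (begin
    g H ∧ (A ⊆ᵇ H) ∧ (H ⊆ᵇ B)   ≡⟨ cong (λ b → g H ∧ (A ⊆ᵇ H) ∧ b) (⊆ᵇ-escape H B e e∈H e∉B) ⟩
    g H ∧ (A ⊆ᵇ H) ∧ false      ≡⟨ cong (g H ∧_) (∧-zeroʳ (A ⊆ᵇ H)) ⟩
    g H ∧ false                 ≡⟨ ∧-zeroʳ (g H) ⟩
    false                       ∎)

-- Intervals through e are intervals of g (H ∪ {e}) over the sets avoiding e
-- (the parity identity behind contraction).
interval-through : {n : ℕ} (g : Subset n → Bool) (A B : Subset n) (e : Fin n) →
  lookup A e ≡ true → lookup B e ≡ true →
  interval (λ H → not (lookup H e) ∧ g (H ∪ ⁅ e ⁆)) (A - e) (B - e) ≡ interval g A B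
interval-through {n} g A B e e∈A e∈B = sym (begin
  interval g A B
    ≡⟨ parity-split n e _ ⟩
  parityOf n (λ H → not (lookup H e) ∧ (g H ∧ (A ⊆ᵇ H) ∧ (H ⊆ᵇ B)))
    xor parityOf n (λ H → not (lookup H e) ∧ (g (H ∪ ⁅ e ⁆) ∧ (A ⊆ᵇ (H ∪ ⁅ e ⁆)) ∧ ((H ∪ ⁅ e ⁆) ⊆ᵇ B)))
    ≡⟨ cong₂ _xor_ (parity-vanish n missing-e) (parity-cong n containing-e) ⟩
  interval (λ H → not (lookup H e) ∧ g (H ∪ ⁅ e ⁆)) (A - e) (B - e) ∎)
  where
  missing-e : ∀ H → not (lookup H e) ∧ (g H ∧ (A ⊆ᵇ H) ∧ (H ⊆ᵇ B)) ≡ false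
  missing-e H with lookup H e in e∉H
  ... | true  = refl
  ... | false = trans (cong (λ b → g H ∧ b ∧ (H ⊆ᵇ B)) (⊆ᵇ-escape A H e e∈A e∉H)) (∧-zeroʳ (g H))
  containing-e : ∀ H →
    not (lookup H e) ∧ (g (H ∪ ⁅ e ⁆) ∧ (A ⊆ᵇ (H ∪ ⁅ e ⁆)) ∧ ((H ∪ ⁅ e ⁆) ⊆ᵇ B))
      ≡ (not (lookup H e) ∧ g (H ∪ ⁅ e ⁆)) ∧ ((A - e) ⊆ᵇ H) ∧ (H ⊆ᵇ (B - e))
  containing-e H with lookup H e in e∉H
  ... | true  = refl
  ... | false = cong₂ (λ a b → g (H ∪ ⁅ e ⁆) ∧ a ∧ b) (⊆ᵇ-∪⁅⁆ A H e)
                      (trans (∪⁅⁆-⊆ᵇ-inside H B e e∈B) (sym (⊆ᵇ-minus-avoid H B e e∉H)))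

-- Folding the cube along e, H ↦ g H xor g (H ∪ {e}), turns intervals whose bottom avoids e
-- and whose top contains e into intervals below B - e (the parity identity behind Penrose contraction).
interval-folded : {n : ℕ} (g : Subset n → Bool) (A B : Subset n) (e : Fin n) →
  lookup A e ≡ false → lookup B e ≡ true →
  interval (λ H → not (lookup H e) ∧ (g H xor g (H ∪ ⁅ e ⁆))) A (B - e) ≡ interval g A B
interval-folded {n} g A B e e∉A e∈B = sym (begin
  interval g A B
    ≡⟨ parity-split n e _ ⟩
  parityOf n (λ H → not (lookup H e) ∧ (g H ∧ (A ⊆ᵇ H) ∧ (H ⊆ᵇ B)))
    xor parityOf n (λ H → not (lookup H e) ∧ (g (H ∪ ⁅ e ⁆) ∧ (A ⊆ᵇ (H ∪ ⁅ e ⁆)) ∧ ((H ∪ ⁅ e ⁆) ⊆ᵇ B)))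
    ≡⟨ parity-xor n _ _ ⟨
  parityOf n (λ H → (not (lookup H e) ∧ (g H ∧ (A ⊆ᵇ H) ∧ (H ⊆ᵇ B)))
    xor (not (lookup H e) ∧ (g (H ∪ ⁅ e ⁆) ∧ (A ⊆ᵇ (H ∪ ⁅ e ⁆)) ∧ ((H ∪ ⁅ e ⁆) ⊆ᵇ B))))
    ≡⟨ parity-cong n summand ⟩
  interval (λ H → not (lookup H e) ∧ (g H xor g (H ∪ ⁅ e ⁆))) A (B - e) ∎)
  where
  summand : ∀ H →
    (not (lookup H e) ∧ (g H ∧ (A ⊆ᵇ H) ∧ (H ⊆ᵇ B)))
      xor (not (lookup H e) ∧ (g (H ∪ ⁅ e ⁆) ∧ (A ⊆ᵇ (H ∪ ⁅ e ⁆)) ∧ ((H ∪ ⁅ e ⁆) ⊆ᵇ B)))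
      ≡ (not (lookup H e) ∧ (g H xor g (H ∪ ⁅ e ⁆))) ∧ (A ⊆ᵇ H) ∧ (H ⊆ᵇ (B - e))
  summand H with lookup H e in e∉H
  ... | true  = refl
  ... | false
    rewrite ⊆ᵇ-∪⁅⁆ A H e | minus-absent A e e∉A | ∪⁅⁆-⊆ᵇ-inside H B e e∈B | ⊆ᵇ-minus-avoid H B e e∉H
    = sym (∧-distribʳ-xor ((A ⊆ᵇ H) ∧ (H ⊆ᵇ B)) (g H) (g (H ∪ ⁅ e ⁆)))

allSubsets-complete : (n : ℕ) (G : Subset n) → G List.∈ allSubsets n
allSubsets-complete zero    []            = hereₗ refl
allSubsets-complete (suc n) (outside ∷ G) = ∈-++⁺ˡ (∈-map⁺ (outside ∷_) (allSubsets-complete n G))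
allSubsets-complete (suc n) (inside ∷ G)  =
  ∈-++⁺ʳ (map (outside ∷_) (allSubsets n)) (∈-map⁺ (inside ∷_) (allSubsets-complete n G))

isOdd-countBetween : {n : ℕ} (S : SetSystem n) (A B : Subset n) →
  isOdd (countBetween S A B) ≡ interval (isFeasible S) A B
isOdd-countBetween {n} S A B =
  trans (isOdd-filter (λ H → isFeasible S H ∧ (A ⊆ᵇ H) ∧ (H ⊆ᵇ B)) (allSubsets n)) (xorAll-allSubsets n _)

feasible⇒⊆ground : {n : ℕ} (S : SetSystem n) (G : Subset n) → isFeasible S G ≡ true → G ⊆ᵇ ground S ≡ true
feasible⇒⊆ground S G = ∧-conicalˡ (G ⊆ᵇ ground S) (feas S G)

∧-implied : (c x : Bool) → (x ≡ true → c ≡ true) → c ∧ x ≡ x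
∧-implied c false _   = ∧-zeroʳ c
∧-implied c true  x⇒c = trans (∧-identityʳ c) (x⇒c refl)

∧-absorb : (c m x : Bool) → (x ≡ true → c ≡ true) → (c ∧ m) ∧ (m ∧ x) ≡ m ∧ x
∧-absorb true  true  x _   = refl
∧-absorb true  false x _   = refl
∧-absorb false m     x x⇒c = trans (sym (∧-zeroʳ m)) (cong (m ∧_) (∧-implied false x x⇒c))

feasible-rawDelete : {n : ℕ} (S : SetSystem n) (e : Fin n) (G : Subset n) →
  isFeasible (rawDelete S e) G ≡ not (lookup G e) ∧ isFeasible S G
feasible-rawDelete S e G =
  trans (cong (_∧ (not (lookup G e) ∧ isFeasible S G)) (⊆ᵇ-minus G (ground S) e))
        (∧-absorb (G ⊆ᵇ ground S) (not (lookup G e)) (isFeasible S G) (feasible⇒⊆ground S G))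

feasible-rawContract : {n : ℕ} (S : SetSystem n) (e : Fin n) (G : Subset n) →
  isFeasible (rawContract S e) G ≡ not (lookup G e) ∧ isFeasible S (G ∪ ⁅ e ⁆)
feasible-rawContract S e G =
  trans (cong (_∧ (not (lookup G e) ∧ isFeasible S (G ∪ ⁅ e ⁆))) (⊆ᵇ-minus G (ground S) e))
        (∧-absorb (G ⊆ᵇ ground S) (not (lookup G e)) (isFeasible S (G ∪ ⁅ e ⁆)) G⊆E)
  where
  G⊆E : isFeasible S (G ∪ ⁅ e ⁆) ≡ true → G ⊆ᵇ ground S ≡ true
  G⊆E h = ∧-conicalˡ _ _ (trans (sym (∪⁅⁆-⊆ᵇ G (ground S) e)) (feasible⇒⊆ground S (G ∪ ⁅ e ⁆) h))

feasible-loopComp : {n : ℕ} (S : SetSystem n) (e : Fin n) (G : Subset n) →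
  lookup (ground S) e ≡ true → lookup G e ≡ false →
  isFeasible (loopComp S ⁅ e ⁆) (G ∪ ⁅ e ⁆) ≡ isFeasible S G xor isFeasible S (G ∪ ⁅ e ⁆)
feasible-loopComp S e G e∈E e∉G = begin
  c ∧ isOdd (countBetween S ((G ∪ ⁅ e ⁆) - e) (G ∪ ⁅ e ⁆))
    ≡⟨ cong (c ∧_) (isOdd-countBetween S _ _) ⟩
  c ∧ interval (isFeasible S) ((G ∪ ⁅ e ⁆) - e) (G ∪ ⁅ e ⁆)
    ≡⟨ cong (λ A → c ∧ interval (isFeasible S) A (G ∪ ⁅ e ⁆)) (∪⁅⁆-minus G e e∉G) ⟩
  c ∧ interval (isFeasible S) G (G ∪ ⁅ e ⁆)
    ≡⟨ cong (c ∧_) (interval-pair (isFeasible S) G e e∉G) ⟩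
  c ∧ (isFeasible S G xor isFeasible S (G ∪ ⁅ e ⁆))
    ≡⟨ ∧-distribˡ-xor c _ _ ⟩
  (c ∧ isFeasible S G) xor (c ∧ isFeasible S (G ∪ ⁅ e ⁆))
    ≡⟨ cong₂ _xor_ (∧-implied c _ G-within) (∧-implied c _ (feasible⇒⊆ground S (G ∪ ⁅ e ⁆))) ⟩
  isFeasible S G xor isFeasible S (G ∪ ⁅ e ⁆) ∎
  where
  c : Bool
  c = (G ∪ ⁅ e ⁆) ⊆ᵇ ground S
  G-within : isFeasible S G ≡ true → c ≡ true
  G-within h = trans (∪⁅⁆-⊆ᵇ G (ground S) e) (cong₂ _∧_ (feasible⇒⊆ground S G h) e∈E)

feasible-rawPenrose : {n : ℕ} (S : SetSystem n) (e : Fin n) (G : Subset n) → lookup (ground S) e ≡ true →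
  isFeasible (rawContract (loopComp S ⁅ e ⁆) e) G ≡
    not (lookup G e) ∧ (isFeasible S G xor isFeasible S (G ∪ ⁅ e ⁆))
feasible-rawPenrose S e G e∈E =
  trans (feasible-rawContract (loopComp S ⁅ e ⁆) e G) (by-membership (lookup G e) refl)
  where
  by-membership : (b : Bool) → lookup G e ≡ b →
    not b ∧ isFeasible (loopComp S ⁅ e ⁆) (G ∪ ⁅ e ⁆) ≡ not b ∧ (isFeasible S G xor isFeasible S (G ∪ ⁅ e ⁆))
  by-membership true  _   = refl
  by-membership false e∉G = feasible-loopComp S e G e∈E e∉G

-- σ_{S\e}(A, B) = σ_S(A, B) for e ∉ B; here and below σ_S(A, B) = interval (isFeasible S) A B.
interval-rawDelete : {n : ℕ} (S : SetSystem n) (e : Fin n) (A B : Subset n) → lookup B e ≡ false →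
  interval (isFeasible (rawDelete S e)) A B ≡ interval (isFeasible S) A B
interval-rawDelete S e A B e∉B =
  trans (interval-cong A B (feasible-rawDelete S e)) (interval-avoiding (isFeasible S) A B e e∉B)

interval-rawContract : {n : ℕ} (S : SetSystem n) (e : Fin n) (A B : Subset n) →
  lookup A e ≡ true → lookup B e ≡ true →
  interval (isFeasible (rawContract S e)) (A - e) (B - e) ≡ interval (isFeasible S) A B
interval-rawContract S e A B e∈A e∈B =
  trans (interval-cong (A - e) (B - e) (feasible-rawContract S e)) (interval-through (isFeasible S) A B e e∈A e∈B)

interval-rawPenrose : {n : ℕ} (S : SetSystem n) (e : Fin n) (A B : Subset n) → lookup (ground S) e ≡ true →
  lookup A e ≡ false → lookup B e ≡ true →
  interval (isFeasible (rawContract (loopComp S ⁅ e ⁆) e)) A (B - e) ≡ interval (isFeasible S) A B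
interval-rawPenrose S e A B e∈E e∉A e∈B =
  trans (interval-cong A (B - e) (λ G → feasible-rawPenrose S e G e∈E))
        (interval-folded (isFeasible S) A B e e∉A e∈B)

coloop-contains : {n : ℕ} (S : SetSystem n) (e : Fin n) (H : Subset n) →
  isColoop S e ≡ true → isFeasible S H ≡ true → lookup H e ≡ true
coloop-contains {n} S e H coloop feasible = Equivalence.to T-≡
  (subst (λ b → T (not b ∨ lookup H e)) feasible
         (All.lookup (all⁺ _ (allSubsets n) (Equivalence.from T-≡ coloop)) (allSubsets-complete n H)))

loop-avoids : {n : ℕ} (S : SetSystem n) (e : Fin n) (H : Subset n) →
  isLoop S e ≡ true → isFeasible S H ∧ lookup H e ≡ false
loop-avoids {n} S e H loop with isFeasible S H ∧ lookup H e in e∈H∈𝓕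
... | false = refl
... | true  = case trans (sym loop) (cong not some) of λ ()
  where
  some : any (λ F → isFeasible S F ∧ lookup F e) (allSubsets n) ≡ true
  some = Equivalence.to T-≡ (any⁺ _ (lose (allSubsets-complete n H) (Equivalence.from T-≡ e∈H∈𝓕)))

rawContract-loop : {n : ℕ} (S : SetSystem n) (e : Fin n) (H : Subset n) →
  isLoop S e ≡ true → isFeasible (rawContract S e) H ≡ false
rawContract-loop S e H loop = begin
  isFeasible (rawContract S e) H                      ≡⟨ feasible-rawContract S e H ⟩
  not (lookup H e) ∧ isFeasible S (H ∪ ⁅ e ⁆)         ≡⟨ cong (not (lookup H e) ∧_) H+e∉𝓕 ⟩
  not (lookup H e) ∧ false                            ≡⟨ ∧-zeroʳ _ ⟩
  false                                               ∎
  where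
  H+e∉𝓕 : isFeasible S (H ∪ ⁅ e ⁆) ≡ false
  H+e∉𝓕 = begin
    isFeasible S (H ∪ ⁅ e ⁆)                              ≡⟨ ∧-identityʳ _ ⟨
    isFeasible S (H ∪ ⁅ e ⁆) ∧ true                       ≡⟨ cong (isFeasible S (H ∪ ⁅ e ⁆) ∧_) (lookup-∪⁅⁆ H e) ⟨
    isFeasible S (H ∪ ⁅ e ⁆) ∧ lookup (H ∪ ⁅ e ⁆) e       ≡⟨ loop-avoids S e (H ∪ ⁅ e ⁆) loop ⟩
    false                                                 ∎

interval-coloop : {n : ℕ} (S : SetSystem n) (e : Fin n) (A B : Subset n) →
  isColoop S e ≡ true → lookup B e ≡ false → interval (isFeasible S) A B ≡ false
interval-coloop S e A B coloop e∉B = interval-empty (isFeasible S) A B λ H _ H⊆B →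
  ¬-not (λ H∈𝓕 → not-¬ (coloop-contains S e H coloop H∈𝓕) (⊆ᵇ-absent H B e H⊆B e∉B))

interval-loop : {n : ℕ} (S : SetSystem n) (e : Fin n) (A B : Subset n) →
  isLoop S e ≡ true → lookup A e ≡ true → interval (isFeasible S) A B ≡ false
interval-loop S e A B loop e∈A = interval-empty (isFeasible S) A B λ H A⊆H _ →
  ¬-not (λ H∈𝓕 → not-¬ (cong₂ _∧_ H∈𝓕 (⊆ᵇ-present A H e A⊆H e∈A)) (loop-avoids S e H loop))

delete-regular : {n : ℕ} (S : SetSystem n) (e : Fin n) → isColoop S e ≡ false → delete S e ≡ rawDelete S e
delete-regular S e = cong (λ b → if b then rawContract S e else rawDelete S e)

contract-regular : {n : ℕ} (S : SetSystem n) (e : Fin n) → isLoop S e ≡ false → contract S e ≡ rawContract S e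
contract-regular S e = cong (λ b → if b then rawDelete S e else rawContract S e)

admissible? : {n : ℕ} → SetSystem n → (X Y Z F : Subset n) → Bool
admissible? S X Y Z F = (F ⊆ᵇ (ground S ─ (X ∪ Y ∪ Z))) ∧ interval (isFeasible S) (F ∪ Y) (F ∪ Y ∪ Z)

admissible?-reflects : {n : ℕ} (S : SetSystem n) (X Y Z F : Subset n) →
  T (admissible? S X Y Z F) ⇔ Admissible S X Y Z F
admissible?-reflects {n} S X Y Z F = mk⇔ to from
  where
  R : Subset n
  R = ground S ─ (X ∪ Y ∪ Z)
  parity : isOdd (countBetween S (F ∪ Y) (F ∪ Y ∪ Z)) ≡ interval (isFeasible S) (F ∪ Y) (F ∪ Y ∪ Z)
  parity = isOdd-countBetween S (F ∪ Y) (F ∪ Y ∪ Z)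
  to : T (admissible? S X Y Z F) → Admissible S X Y Z F
  to t = let (F⊆R , odd) = Equivalence.to (T-∧ {F ⊆ᵇ R}) t in toWitness F⊆R , subst T (sym parity) odd
  from : Admissible S X Y Z F → T (admissible? S X Y Z F)
  from (F⊆R , odd) = Equivalence.from (T-∧ {F ⊆ᵇ R}) (fromWitness {A = F ⊆ R} F⊆R , subst T parity odd)

lookup-∪ : {n : ℕ} (A B : Subset n) (e : Fin n) → lookup (A ∪ B) e ≡ lookup A e ∨ lookup B e
lookup-∪ A B e = lookup-zipWith _∨_ e A B

∈-∪ˡ : {n : ℕ} (A B : Subset n) (e : Fin n) → lookup A e ≡ true → lookup (A ∪ B) e ≡ true
∈-∪ˡ A B e e∈A = trans (lookup-∪ A B e) (cong (_∨ lookup B e) e∈A)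

∈-∪ʳ : {n : ℕ} (A B : Subset n) (e : Fin n) → lookup B e ≡ true → lookup (A ∪ B) e ≡ true
∈-∪ʳ A B e e∈B = trans (lookup-∪ A B e) (trans (cong (lookup A e ∨_) e∈B) (∨-zeroʳ (lookup A e)))

∉-∪ : {n : ℕ} (A B : Subset n) (e : Fin n) → lookup A e ≡ false → lookup B e ≡ false →
  lookup (A ∪ B) e ≡ false
∉-∪ A B e e∉A e∉B = trans (lookup-∪ A B e) (cong₂ _∨_ e∉A e∉B)

⊆-lookup : {n : ℕ} {A B : Subset n} → A ⊆ B → (e : Fin n) → lookup A e ≡ true → lookup B e ≡ true
⊆-lookup {A = A} A⊆B e e∈A = []=⇒lookup (A⊆B (lookup⇒[]= e A e∈A))

disjoint-lookup : {n : ℕ} {A B : Subset n} → Empty (A ∩ B) → (e : Fin n) → lookup A e ≡ true → lookup B e ≡ false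
disjoint-lookup {A = A} {B} A∩B≡∅ e e∈A = ¬-not λ e∈B →
  A∩B≡∅ (e , lookup⇒[]= e (A ∩ B) (trans (lookup-zipWith _∧_ e A B) (cong₂ _∧_ e∈A e∈B)))

∪-minus : {n : ℕ} (A B : Subset n) (e : Fin n) → (A ∪ B) - e ≡ (A - e) ∪ (B - e)
∪-minus (x ∷ A) (y ∷ B) zero    = cong (outside ∷_) (trans (p─⊥≡p (A ∪ B)) (sym (cong₂ _∪_ (p─⊥≡p A) (p─⊥≡p B))))
∪-minus (x ∷ A) (y ∷ B) (suc e) = cong ((x ∨ y) ∷_) (∪-minus A B e)

minus-remaining : {n : ℕ} (E U : Subset n) (e : Fin n) → lookup U e ≡ true → (E - e) ─ (U - e) ≡ E ─ U
minus-remaining (x ∷ E) (inside ∷ U)  zero    refl = cong (outside ∷_) (cong₂ _─_ (p─⊥≡p E) (p─⊥≡p U))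
minus-remaining (x ∷ E) (outside ∷ U) (suc e) e∈U  = cong (x ∷_) (minus-remaining E U e e∈U)
minus-remaining (x ∷ E) (inside ∷ U)  (suc e) e∈U  = cong (outside ∷_) (minus-remaining E U e e∈U)

lookup-remaining : {n : ℕ} (E U : Subset n) (e : Fin n) → lookup U e ≡ true → lookup (E ─ U) e ≡ false
lookup-remaining (x ∷ E) (inside ∷ U) zero    refl = refl
lookup-remaining (x ∷ E) (y ∷ U)      (suc e) e∈U  = lookup-remaining E U e e∈U

remainder-minus : {n : ℕ} (E X Y Z : Subset n) (e : Fin n) → lookup (X ∪ Y ∪ Z) e ≡ true →
  (E - e) ─ ((X - e) ∪ (Y - e) ∪ (Z - e)) ≡ E ─ (X ∪ Y ∪ Z)
remainder-minus E X Y Z e e∈U = begin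
  (E - e) ─ ((X - e) ∪ (Y - e) ∪ (Z - e))
    ≡⟨ cong ((E - e) ─_) (trans (∪-minus X (Y ∪ Z) e) (cong ((X - e) ∪_) (∪-minus Y Z e))) ⟨
  (E - e) ─ ((X ∪ Y ∪ Z) - e)
    ≡⟨ minus-remaining E (X ∪ Y ∪ Z) e e∈U ⟩
  E ─ (X ∪ Y ∪ Z) ∎

∧-cong-guarded : {c c′ o o′ : Bool} → c′ ≡ c → (c ≡ true → o′ ≡ o) → c′ ∧ o′ ≡ c ∧ o
∧-cong-guarded {false} refl _  = refl
∧-cong-guarded {true}  refl o≡ = o≡ refl

admissible-step : {n : ℕ} (S S′ : SetSystem n) (X Y Z : Subset n) (e : Fin n) →
  lookup (X ∪ Y ∪ Z) e ≡ true → ground S′ ≡ ground S - e →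
  (∀ F → lookup F e ≡ false →
     interval (isFeasible S′) ((F ∪ Y) - e) ((F ∪ Y ∪ Z) - e) ≡ interval (isFeasible S) (F ∪ Y) (F ∪ Y ∪ Z)) →
  ∀ F → admissible? S′ (X - e) (Y - e) (Z - e) F ≡ admissible? S X Y Z F
admissible-step S S′ X Y Z e e∈U E′≡E-e same-parities F =
  ∧-cong-guarded (cong (F ⊆ᵇ_) same-remainder) same-parity
  where
  same-remainder : ground S′ ─ ((X - e) ∪ (Y - e) ∪ (Z - e)) ≡ ground S ─ (X ∪ Y ∪ Z)
  same-remainder = trans (cong (_─ _) E′≡E-e) (remainder-minus (ground S) X Y Z e e∈U)
  same-parity : F ⊆ᵇ (ground S ─ (X ∪ Y ∪ Z)) ≡ true →
    interval (isFeasible S′) (F ∪ (Y - e)) (F ∪ (Y - e) ∪ (Z - e)) ≡ interval (isFeasible S) (F ∪ Y) (F ∪ Y ∪ Z)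
  same-parity F⊆ = subst₂ (λ A B → interval (isFeasible S′) A B ≡ _) lower upper (same-parities F e∉F)
    where
    e∉F : lookup F e ≡ false
    e∉F = ⊆ᵇ-absent F _ e F⊆ (lookup-remaining (ground S) (X ∪ Y ∪ Z) e e∈U)
    lower : (F ∪ Y) - e ≡ F ∪ (Y - e)
    lower = trans (∪-minus F Y e) (cong (_∪ (Y - e)) (minus-absent F e e∉F))
    upper : (F ∪ Y ∪ Z) - e ≡ F ∪ (Y - e) ∪ (Z - e)
    upper = trans (∪-minus F (Y ∪ Z) e) (cong₂ _∪_ (minus-absent F e e∉F) (∪-minus Y Z e))

targets : {n : ℕ} → Op → Subset n → Subset n → Subset n → Subset n
targets del X Y Z = X
targets con X Y Z = Y
targets pen X Y Z = Z

target-removed : {n : ℕ} (o : Op) (X Y Z : Subset n) (e : Fin n) →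
  lookup (targets o X Y Z) e ≡ true → lookup (X ∪ Y ∪ Z) e ≡ true
target-removed del X Y Z e e∈X = ∈-∪ˡ X (Y ∪ Z) e e∈X
target-removed con X Y Z e e∈Y = ∈-∪ʳ X (Y ∪ Z) e (∈-∪ˡ Y Z e e∈Y)
target-removed pen X Y Z e e∈Z = ∈-∪ʳ X (Y ∪ Z) e (∈-∪ʳ Y Z e e∈Z)

∉-minus-self : {n : ℕ} (A : Subset n) (e : Fin n) → e ∉ A - e
∉-minus-self (x ∷ A) zero    ()
∉-minus-self (x ∷ A) (suc e) (there e∈A-e) = ∉-minus-self A e e∈A-e

minus-⊆ : {n : ℕ} {A B : Subset n} (e : Fin n) → A ⊆ B → A - e ⊆ B - e
minus-⊆ {A = A} e A⊆B {x} x∈A-e =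
  x∈p∧x≢y⇒x∈p-y (A⊆B (p─q⊆p A ⁅ e ⁆ x∈A-e)) (λ { refl → ∉-minus-self A e x∈A-e })

disjoint-⊆ : {n : ℕ} {A B A′ B′ : Subset n} → Empty (A ∩ B) → A′ ⊆ A → B′ ⊆ B → Empty (A′ ∩ B′)
disjoint-⊆ {A′ = A′} {B′} A∩B≡∅ A′⊆A B′⊆B (x , x∈A′∩B′) =
  let (x∈A′ , x∈B′) = x∈p∩q⁻ A′ B′ x∈A′∩B′ in A∩B≡∅ (x , x∈p∩q⁺ (A′⊆A x∈A′ , B′⊆B x∈B′))

record Setup {n : ℕ} (S : SetSystem n) (X Y Z : Subset n) : Set where
  field
    Z⊆E     : Z ⊆ ground S
    X∩Y≡∅   : Empty (X ∩ Y)
    X∩Z≡∅   : Empty (X ∩ Z)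
    Y∩Z≡∅   : Empty (Y ∩ Z)
    witness : ∃ λ F → admissible? S X Y Z F ≡ true

module OneStep {n : ℕ} {S : SetSystem n} {X Y Z : Subset n} (setup : Setup S X Y Z) (e : Fin n) where
  open Setup setup

  F₀ : Subset n
  F₀ = proj₁ witness

  F₀-parity : interval (isFeasible S) (F₀ ∪ Y) (F₀ ∪ Y ∪ Z) ≡ true
  F₀-parity = ∧-conicalʳ _ _ (proj₂ witness)

  F₀-avoids : lookup (X ∪ Y ∪ Z) e ≡ true → lookup F₀ e ≡ false
  F₀-avoids e∈U = ⊆ᵇ-absent F₀ _ e (∧-conicalˡ _ _ (proj₂ witness)) (lookup-remaining (ground S) _ e e∈U)

  Preserves : SetSystem n → Set
  Preserves S′ = (ground S′ ≡ ground S - e) ×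
                 (∀ F → admissible? S′ (X - e) (Y - e) (Z - e) F ≡ admissible? S X Y Z F)

  deletion-step : lookup X e ≡ true → Preserves (delete S e)
  deletion-step e∈X = subst Preserves (sym (delete-regular S e not-coloop)) (refl ,
    admissible-step S (rawDelete S e) X Y Z e e∈U refl λ F e∉F →
      trans (cong₂ (interval (isFeasible (rawDelete S e))) (minus-absent _ e (e∉A F e∉F)) (minus-absent _ e (e∉B F e∉F)))
            (interval-rawDelete S e (F ∪ Y) (F ∪ Y ∪ Z) (e∉B F e∉F)))
    where
    e∈U : lookup (X ∪ Y ∪ Z) e ≡ true
    e∈U = target-removed del X Y Z e e∈X
    e∉Y : lookup Y e ≡ false
    e∉Y = disjoint-lookup X∩Y≡∅ e e∈X
    e∉Z : lookup Z e ≡ false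
    e∉Z = disjoint-lookup X∩Z≡∅ e e∈X
    e∉A : ∀ F → lookup F e ≡ false → lookup (F ∪ Y) e ≡ false
    e∉A F e∉F = ∉-∪ F Y e e∉F e∉Y
    e∉B : ∀ F → lookup F e ≡ false → lookup (F ∪ Y ∪ Z) e ≡ false
    e∉B F e∉F = ∉-∪ F (Y ∪ Z) e e∉F (∉-∪ Y Z e e∉Y e∉Z)
    not-coloop : isColoop S e ≡ false
    not-coloop = ¬-not λ coloop →
      not-¬ F₀-parity (interval-coloop S e (F₀ ∪ Y) (F₀ ∪ Y ∪ Z) coloop (e∉B F₀ (F₀-avoids e∈U)))

  contraction-step : lookup Y e ≡ true → Preserves (contract S e)
  contraction-step e∈Y = subst Preserves (sym (contract-regular S e not-loop)) (refl ,
    admissible-step S (rawContract S e) X Y Z e (target-removed con X Y Z e e∈Y) refl λ F _ →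
      interval-rawContract S e (F ∪ Y) (F ∪ Y ∪ Z) (e∈A F) (e∈B F))
    where
    e∈A : ∀ F → lookup (F ∪ Y) e ≡ true
    e∈A F = ∈-∪ʳ F Y e e∈Y
    e∈B : ∀ F → lookup (F ∪ Y ∪ Z) e ≡ true
    e∈B F = ∈-∪ʳ F (Y ∪ Z) e (∈-∪ˡ Y Z e e∈Y)
    not-loop : isLoop S e ≡ false
    not-loop = ¬-not λ loop → not-¬ F₀-parity (interval-loop S e (F₀ ∪ Y) (F₀ ∪ Y ∪ Z) loop (e∈A F₀))

  penrose-step : lookup Z e ≡ true → Preserves (penrose S e)
  penrose-step e∈Z = subst Preserves (sym (contract-regular S⁺ e not-loop)) (refl ,
    admissible-step S (rawContract S⁺ e) X Y Z e e∈U refl λ F e∉F →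
      trans (cong (λ A → interval (isFeasible (rawContract S⁺ e)) A ((F ∪ Y ∪ Z) - e))
                  (minus-absent (F ∪ Y) e (e∉A F e∉F)))
            (interval-rawPenrose S e (F ∪ Y) (F ∪ Y ∪ Z) e∈E (e∉A F e∉F) (e∈B F)))
    where
    S⁺ : SetSystem n
    S⁺ = loopComp S ⁅ e ⁆
    e∈E : lookup (ground S) e ≡ true
    e∈E = ⊆-lookup Z⊆E e e∈Z
    e∈U : lookup (X ∪ Y ∪ Z) e ≡ true
    e∈U = target-removed pen X Y Z e e∈Z
    e∉Y : lookup Y e ≡ false
    e∉Y = disjoint-lookup (subst Empty (∩-comm Y Z) Y∩Z≡∅) e e∈Z
    e∉A : ∀ F → lookup F e ≡ false → lookup (F ∪ Y) e ≡ false
    e∉A F e∉F = ∉-∪ F Y e e∉F e∉Y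
    e∈B : ∀ F → lookup (F ∪ Y ∪ Z) e ≡ true
    e∈B F = ∈-∪ʳ F (Y ∪ Z) e (∈-∪ʳ Y Z e e∈Z)
    not-loop : isLoop S⁺ e ≡ false
    not-loop = ¬-not λ loop → not-¬ (begin
      interval (isFeasible S) (F₀ ∪ Y) (F₀ ∪ Y ∪ Z)
        ≡⟨ interval-rawPenrose S e (F₀ ∪ Y) (F₀ ∪ Y ∪ Z) e∈E (e∉A F₀ (F₀-avoids e∈U)) (e∈B F₀) ⟨
      interval (isFeasible (rawContract S⁺ e)) (F₀ ∪ Y) ((F₀ ∪ Y ∪ Z) - e)
        ≡⟨ interval-empty _ _ _ (λ H _ _ → rawContract-loop S⁺ e H loop) ⟩
      false ∎) F₀-parity

  step : ∀ o → lookup (targets o X Y Z) e ≡ true → Preserves (applyOp S (e , o))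
  step del = deletion-step
  step con = contraction-step
  step pen = penrose-step

  next-setup : {S′ : SetSystem n} → Preserves S′ → Setup S′ (X - e) (Y - e) (Z - e)
  next-setup (E′≡E-e , same-admissible) = record
    { Z⊆E     = subst (Z - e ⊆_) (sym E′≡E-e) (minus-⊆ e Z⊆E)
    ; X∩Y≡∅   = disjoint-⊆ X∩Y≡∅ (p─q⊆p X ⁅ e ⁆) (p─q⊆p Y ⁅ e ⁆)
    ; X∩Z≡∅   = disjoint-⊆ X∩Z≡∅ (p─q⊆p X ⁅ e ⁆) (p─q⊆p Z ⁅ e ⁆)
    ; Y∩Z≡∅   = disjoint-⊆ Y∩Z≡∅ (p─q⊆p Y ⁅ e ⁆) (p─q⊆p Z ⁅ e ⁆)
    ; witness = F₀ , trans (same-admissible F₀) (proj₂ witness)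
    }

-- A sequence of operations treating each element of X, Y, Z once, with the kind its set prescribes;
-- this is ValidOrder with the three kinds handled uniformly.
Schedule : {n : ℕ} → Subset n → Subset n → Subset n → List (Fin n × Op) → Set
Schedule X Y Z ops = Unique (map proj₁ ops) × (∀ e o → (e , o) List.∈ ops ⇔ e ∈ targets o X Y Z)

validOrder⇒schedule : {n : ℕ} {X Y Z : Subset n} (ops : List (Fin n × Op)) →
  ValidOrder X Y Z ops → Schedule X Y Z ops
validOrder⇒schedule ops (unique , del⇔X , con⇔Y , pen⇔Z) = unique , λ where
  e del → del⇔X e
  e con → con⇔Y e
  e pen → pen⇔Z e

targets-minus : {n : ℕ} (o : Op) (X Y Z : Subset n) (e : Fin n) →
  targets o (X - e) (Y - e) (Z - e) ≡ targets o X Y Z - e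
targets-minus del X Y Z e = refl
targets-minus con X Y Z e = refl
targets-minus pen X Y Z e = refl

schedule-[] : {n : ℕ} {X Y Z : Subset n} → Schedule X Y Z [] → (X ≡ ⊥) × (Y ≡ ⊥) × (Z ≡ ⊥)
schedule-[] {X = X} {Y} {Z} (_ , member) = unscheduled del , unscheduled con , unscheduled pen
  where
  unscheduled : ∀ o → targets o X Y Z ≡ ⊥
  unscheduled o = Empty-unique λ (x , x∈T) → case Equivalence.from (member x o) x∈T of λ ()

schedule-∷ : {n : ℕ} {X Y Z : Subset n} (e : Fin n) (o : Op) (ops : List (Fin n × Op)) →
  Schedule X Y Z ((e , o) ∷ ops) →
  lookup (targets o X Y Z) e ≡ true × Schedule (X - e) (Y - e) (Z - e) ops
schedule-∷ {X = X} {Y} {Z} e o ops (e-fresh ∷ₚ unique , member) =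
  []=⇒lookup (Equivalence.to (member e o) (hereₗ refl)) , unique ,
  λ e′ o′ → subst (λ T → (e′ , o′) List.∈ ops ⇔ e′ ∈ T) (sym (targets-minus o′ X Y Z e)) (later e′ o′)
  where
  later : ∀ e′ o′ → (e′ , o′) List.∈ ops ⇔ e′ ∈ targets o′ X Y Z - e
  later e′ o′ = mk⇔
    (λ m → x∈p∧x≢y⇒x∈p-y (Equivalence.to (member e′ o′) (thereₗ m))
                          (λ e′≡e → All.lookup e-fresh (∈-map⁺ proj₁ m) (sym e′≡e)))
    (λ m → case Equivalence.from (member e′ o′) (p─q⊆p _ ⁅ e ⁆ m) of λ where
      (hereₗ refl) → ⊥-elim (∉-minus-self _ e m)
      (thereₗ m′)  → m′)

Outcome : {n : ℕ} → List (Fin n × Op) → SetSystem n → Subset n → Subset n → Subset n → Set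
Outcome ops S X Y Z = (ground (applyOps S ops) ≡ ground S ─ (X ∪ Y ∪ Z)) ×
                      (∀ F → isFeasible (applyOps S ops) F ≡ admissible? S X Y Z F)

no-operations : {n : ℕ} (S : SetSystem n) → Outcome [] S ⊥ ⊥ ⊥
no-operations S = sym E─∅≡E , λ F → sym (begin
  (F ⊆ᵇ (ground S ─ (⊥ ∪ ⊥ ∪ ⊥))) ∧ interval (isFeasible S) (F ∪ ⊥) (F ∪ ⊥ ∪ ⊥)
    ≡⟨ cong₂ _∧_ (cong (F ⊆ᵇ_) E─∅≡E)
                 (cong₂ (interval (isFeasible S)) (∪-identityʳ F) (trans (cong (F ∪_) ∅∪∅≡∅) (∪-identityʳ F))) ⟩
  (F ⊆ᵇ ground S) ∧ interval (isFeasible S) F F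
    ≡⟨ cong ((F ⊆ᵇ ground S) ∧_) (interval-point (isFeasible S) F) ⟩
  (F ⊆ᵇ ground S) ∧ isFeasible S F
    ≡⟨ ∧-implied (F ⊆ᵇ ground S) (isFeasible S F) (feasible⇒⊆ground S F) ⟩
  isFeasible S F ∎)
  where
  ∅∪∅≡∅ : ⊥ ∪ ⊥ ≡ ⊥
  ∅∪∅≡∅ = ∪-identityʳ ⊥
  E─∅≡E : ground S ─ (⊥ ∪ ⊥ ∪ ⊥) ≡ ground S
  E─∅≡E = trans (cong (λ U → ground S ─ (⊥ ∪ U)) ∅∪∅≡∅) (trans (cong (ground S ─_) ∅∪∅≡∅) (p─⊥≡p (ground S)))

characterisation : {n : ℕ} (ops : List (Fin n × Op)) (S : SetSystem n) (X Y Z : Subset n) →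
  Schedule X Y Z ops → Setup S X Y Z → Outcome ops S X Y Z
characterisation [] S X Y Z schedule _ with schedule-[] schedule
... | refl , refl , refl = no-operations S
characterisation ((e , o) ∷ ops) S X Y Z schedule setup =
  trans (proj₁ later) (trans (cong (_─ _) (proj₁ preserved)) (remainder-minus (ground S) X Y Z e e∈U)) ,
  λ F → trans (proj₂ later F) (proj₂ preserved F)
  where
  open OneStep setup e
  e∈T : lookup (targets o X Y Z) e ≡ true
  e∈T = proj₁ (schedule-∷ e o ops schedule)
  e∈U : lookup (X ∪ Y ∪ Z) e ≡ true
  e∈U = target-removed o X Y Z e e∈T
  preserved : Preserves (applyOp S (e , o))
  preserved = step o e∈T
  later : Outcome ops (applyOp S (e , o)) (X - e) (Y - e) (Z - e)
  later = characterisation ops (applyOp S (e , o)) (X - e) (Y - e) (Z - e)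
            (proj₂ (schedule-∷ e o ops schedule)) (next-setup preserved)

T-cong : {b c : Bool} → b ≡ c → T b ⇔ T c
T-cong b≡c = mk⇔ (subst T b≡c) (subst T (sym b≡c))

lemma3p2 : {n : ℕ} (S : SetSystem n) (X Y Z : Subset n) →
    Proper S →
    X ⊆ ground S → Y ⊆ ground S → Z ⊆ ground S →
    Empty (X ∩ Y) → Empty (X ∩ Z) → Empty (Y ∩ Z) →
    (∃ λ F → Admissible S X Y Z F) →
    ((ops₁ ops₂ : List (Fin n × Op)) → ValidOrder X Y Z ops₁ → ValidOrder X Y Z ops₂ →
       SameSystem (applyOps S ops₁) (applyOps S ops₂))
    × ((ops : List (Fin n × Op)) → ValidOrder X Y Z ops →
       (ground (applyOps S ops) ≡ ground S ─ (X ∪ Y ∪ Z))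
       × (∀ F → Feasible (applyOps S ops) F ⇔ Admissible S X Y Z F))
lemma3p2 S X Y Z _ _ _ Z⊆E X∩Y≡∅ X∩Z≡∅ Y∩Z≡∅ (F₀ , F₀-admissible) =
  (λ ops₁ ops₂ valid₁ valid₂ →
     trans (proj₁ (outcome valid₁)) (sym (proj₁ (outcome valid₂))) ,
     λ F → ⇔-sym (feasible⇔admissible valid₂ F) ⇔-∘ feasible⇔admissible valid₁ F) ,
  (λ ops valid → proj₁ (outcome valid) , feasible⇔admissible valid)
  where
  setup : Setup S X Y Z
  setup = record
    { Z⊆E = Z⊆E ; X∩Y≡∅ = X∩Y≡∅ ; X∩Z≡∅ = X∩Z≡∅ ; Y∩Z≡∅ = Y∩Z≡∅
    ; witness = F₀ , Equivalence.to T-≡ (Equivalence.from (admissible?-reflects S X Y Z F₀) F₀-admissible) }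
  outcome : ∀ {ops} → ValidOrder X Y Z ops → Outcome ops S X Y Z
  outcome {ops} valid = characterisation ops S X Y Z (validOrder⇒schedule ops valid) setup
  feasible⇔admissible : ∀ {ops} → ValidOrder X Y Z ops → ∀ F → Feasible (applyOps S ops) F ⇔ Admissible S X Y Z F
  feasible⇔admissible valid F = admissible?-reflects S X Y Z F ⇔-∘ T-cong (proj₂ (outcome valid) F)
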